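{- For every finite graph $G$, $\mathrm{box}(G)\le 2\,\mathrm{wcol}^*_2(G)$.
   Context: Graphs are finite and simple. The boxicity $\mathrm{box}(G)$ is the smallest $k$ such that $G$ is the intersection (same vertex set, intersection of edge sets) of $k$ interval graphs. For a linear order $\pi$ on $V(G)$ and an integer $r\ge0$, a vertex $u$ is weakly $r$-reachable from a vertex $v$ (with respect to $\pi$) if there is a path $P$ in $G$ of length (number of edges) at most $r$ between $u$ and $v$ such that $u\le_\pi x$ for every vertex $x$ of $P$. The parameter $\mathrm{wcol}^*_r(G)$ is the minimum $k$ such that for some linear order $\pi$ on $V(G)$ there is a coloring of $V(G)$ with $k$ colors such that for every vertex $v$, every vertex $u\neq v$ weakly $r$-reachable from $v$ has a color distinct from that of $v$. -}

module Defs where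

open import Data.Nat using (ℕ; suc; _≤_)
open import Data.Fin using (Fin; zero; suc; fromℕ; inject₁)
open import Data.Bool using (Bool; true; false)
open import Data.Product using (Σ; _×_; proj₁; proj₂; ∃-syntax)
open import Relation.Binary.PropositionalEquality using (_≡_; _≢_)
open import Function.Definitions using (Injective)

record Graph : Set where
  field
    n      : ℕ
    adj    : Fin n → Fin n → Bool
    sym    : ∀ u v → adj u v ≡ adj v u
    irrefl : ∀ v → adj v v ≡ false
open Graph public

Edge : (G : Graph) → Fin (n G) → Fin (n G) → Set
Edge G u v = adj G u v ≡ true

-- A closed interval [l , r] with l ≤ r (natural-number endpoints suffice
-- for finitely many intervals).
Interval : Set
Interval = ℕ × ℕ

ValidInterval : Interval → Set
ValidInterval I = proj₁ I ≤ proj₂ I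

Meet : Interval → Interval → Set
Meet I J = (proj₁ I ≤ proj₂ J) × (proj₁ J ≤ proj₂ I)

-- box(G) ≤ d : G is the intersection of d interval graphs on V(G),
-- the i-th one given by an interval representation I i.
BoxAtMost : Graph → ℕ → Set
BoxAtMost G d =
  Σ (Fin d → Fin (n G) → Interval) λ I →
    (∀ i v → ValidInterval (I i v)) ×
    (∀ u v → u ≢ v → ((Edge G u v → ∀ i → Meet (I i u) (I i v)) ×
                      ((∀ i → Meet (I i u) (I i v)) → Edge G u v)))

LinearOrder : Graph → Set
LinearOrder G = Σ (Fin (n G) → ℕ) λ rank → Injective _≡_ _≡_ rank

_≤[_]_ : ∀ {G} → Fin (n G) → LinearOrder G → Fin (n G) → Set
u ≤[ π ] v = proj₁ π u ≤ proj₁ π v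

record Path (G : Graph) (m : ℕ) (v u : Fin (n G)) : Set where
  field
    vert   : Fin (suc m) → Fin (n G)
    start  : vert zero ≡ v
    end    : vert (fromℕ m) ≡ u
    edges  : ∀ (i : Fin m) → Edge G (vert (inject₁ i)) (vert (suc i))
    simple : Injective _≡_ _≡_ vert
open Path public

WReach : (G : Graph) → LinearOrder G → ℕ → Fin (n G) → Fin (n G) → Set
WReach G π r v u =
  ∃[ m ] (m ≤ r × Σ (Path G m v u) λ P → ∀ i → _≤[_]_ {G} u π (vert P i))

WColStarAtMost : Graph → ℕ → ℕ → Set
WColStarAtMost G r k =
  Σ (LinearOrder G) λ π → Σ (Fin (n G) → Fin k) λ c →
    ∀ v u → u ≢ v → WReach G π r v u → c u ≢ c v

module Submission where

-- Order the vertices by π and colour them with a wcol*₂-colouring c. For every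
-- colour i and each of the two orders π and its reverse, take the interval
-- representation in which a vertex of colour i is the point at its position,
-- and any other vertex x is the interval from 0 up to the farthest position of
-- a neighbour of x of colour i. Since c is proper, adjacent vertices meet in
-- all 2k of these. If u and v are non-adjacent, then either they share a
-- colour and are separated as distinct points, or, say π u < π v, and meeting
-- in both orders for the colour i of u would give neighbours w₁, w₂ of v of
-- colour i with w₂ <π u ≤π w₁; then w₂ is weakly 2-reachable from w₁ through
-- v, contradicting that they share a colour.

open import Defs hiding (sym)
open import Data.Bool using (true; false; if_then_else_; _∧_)
open import Data.Bool.Properties using () renaming (_≟_ to _≟ᵇ_)
open import Data.Empty using (⊥-elim)
open import Data.Fin as Fin using (Fin; zero; suc; inject₁; remQuot; combine)
open import Data.Fin.Properties using (remQuot-combine)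
open import Data.List using (allFin; map)
open import Data.List.Extrema.Nat using (argmax; f[xs]≤f[argmax]; max; xs≤max)
open import Data.List.Membership.Propositional.Properties using (∈-allFin; ∈-map⁺)
open import Data.List.Relation.Unary.All as All using ()
import Data.Nat as ℕ
open import Data.Nat using (ℕ; _*_; _≤_; _<_; z≤n; s≤s; s≤s⁻¹; _∸_)
open import Data.Nat.Properties
  using ( ≤-refl; ≤-antisym; ≤-trans; <⇒≤; <-≤-trans; <-trans; <⇒≢; <-irrefl; <-cmp
        ; ∸-cancelʳ-≤; ≤∧≢⇒<)
open import Data.Product using (Σ; _×_; _,_; proj₁; proj₂; swap; uncurry)
open import Function.Definitions using (Injective)
open import Relation.Binary using (tri<; tri≈; tri>)
open import Relation.Binary.PropositionalEquality
  using (_≡_; _≢_; refl; sym; trans; cong; subst; subst₂)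
open import Relation.Nullary using (¬_; Dec; yes; no; does; contradiction)
open import Relation.Nullary.Decidable using (dec-true; dec-false)

module _ {G : Graph} where

  private
    V : Set
    V = Fin (n G)

  Edge-sym : ∀ {u v} → Edge G u v → Edge G v u
  Edge-sym {u} {v} e = trans (Graph.sym G v u) e

  Edge⇒≢ : ∀ {u v} → Edge G u v → u ≢ v
  Edge⇒≢ {u} e refl with trans (sym e) (irrefl G u)
  ... | ()

  edgePath : ∀ {a b} → Edge G a b → Path G 1 a b
  edgePath {a} {b} e = record
    { vert = vert′ ; start = refl ; end = refl ; edges = edges′ ; simple = simple′ }
    where
    vert′ : Fin 2 → V
    vert′ zero       = a
    vert′ (suc zero) = b
    edges′ : ∀ (i : Fin 1) → Edge G (vert′ (inject₁ i)) (vert′ (suc i))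
    edges′ zero = e
    simple′ : Injective _≡_ _≡_ vert′
    simple′ {zero}     {zero}     _  = refl
    simple′ {zero}     {suc zero} eq = contradiction eq (Edge⇒≢ e)
    simple′ {suc zero} {zero}     eq = contradiction (sym eq) (Edge⇒≢ e)
    simple′ {suc zero} {suc zero} _  = refl

  twoPath : ∀ {a x b} → Edge G a x → Edge G x b → a ≢ b → Path G 2 a b
  twoPath {a} {x} {b} e₁ e₂ a≢b = record
    { vert = vert′ ; start = refl ; end = refl ; edges = edges′ ; simple = simple′ }
    where
    vert′ : Fin 3 → V
    vert′ zero             = a
    vert′ (suc zero)       = x
    vert′ (suc (suc zero)) = b
    edges′ : ∀ (i : Fin 2) → Edge G (vert′ (inject₁ i)) (vert′ (suc i))
    edges′ zero       = e₁
    edges′ (suc zero) = e₂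
    simple′ : Injective _≡_ _≡_ vert′
    simple′ {zero}             {zero}             _  = refl
    simple′ {zero}             {suc zero}         eq = contradiction eq (Edge⇒≢ e₁)
    simple′ {zero}             {suc (suc zero)}   eq = contradiction eq a≢b
    simple′ {suc zero}         {zero}             eq = contradiction (sym eq) (Edge⇒≢ e₁)
    simple′ {suc zero}         {suc zero}         _  = refl
    simple′ {suc zero}         {suc (suc zero)}   eq = contradiction eq (Edge⇒≢ e₂)
    simple′ {suc (suc zero)}   {zero}             eq = contradiction (sym eq) a≢b
    simple′ {suc (suc zero)}   {suc zero}         eq = contradiction (sym eq) (Edge⇒≢ e₂)
    simple′ {suc (suc zero)}   {suc (suc zero)}   _  = refl

  module _ (π : LinearOrder G) where

    private
      rank : V → ℕ
      rank = proj₁ π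

    wreach-edge : ∀ {ρ a b} → 1 ≤ ρ → Edge G a b → rank b ≤ rank a → WReach G π ρ a b
    wreach-edge 1≤ρ e b≤a = 1 , 1≤ρ , edgePath e , above
      where
      above : ∀ i → rank _ ≤ rank (vert (edgePath e) i)
      above zero       = b≤a
      above (suc zero) = ≤-refl

    wreach-twoPath : ∀ {ρ a x b} → 2 ≤ ρ → Edge G a x → Edge G x b → a ≢ b →
                     rank b ≤ rank a → rank b ≤ rank x → WReach G π ρ a b
    wreach-twoPath 2≤ρ e₁ e₂ a≢b b≤a b≤x = 2 , 2≤ρ , twoPath e₁ e₂ a≢b , above
      where
      above : ∀ i → rank _ ≤ rank (vert (twoPath e₁ e₂ a≢b) i)
      above zero             = b≤a
      above (suc zero)       = b≤x
      above (suc (suc zero)) = ≤-refl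

  boxAtMost-* : ∀ {m k} (I : Fin m → Fin k → V → Interval) →
                (∀ s i v → ValidInterval (I s i v)) →
                (∀ u v → u ≢ v → (Edge G u v → ∀ s i → Meet (I s i u) (I s i v)) ×
                                 ((∀ s i → Meet (I s i u) (I s i v)) → Edge G u v)) →
                BoxAtMost G (m * k)
  boxAtMost-* {m} {k} I valid represents = J , (λ d v → valid _ _ v) , represents′
    where
    J : Fin (m * k) → V → Interval
    J d = uncurry I (remQuot k d)
    represents′ : ∀ u v → u ≢ v → (Edge G u v → ∀ d → Meet (J d u) (J d v)) ×
                                  ((∀ d → Meet (J d u) (J d v)) → Edge G u v)
    represents′ u v u≢v = (λ e d → proj₁ (represents u v u≢v) e _ _) , λ meets →
      proj₂ (represents u v u≢v) λ s i →
        subst (λ si → Meet (uncurry I si u) (uncurry I si v))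
              (remQuot-combine s i) (meets (combine s i))

module ColourClassIntervals (G : Graph) {k : ℕ} (c : Fin (n G) → Fin k) (ρ : Fin (n G) → ℕ)
  where

  private
    V : Set
    V = Fin (n G)

  -- Positions are shifted by one so that a vertex with no neighbour of colour i,
  -- whose interval is [0, 0], meets no point of colour i.
  position : V → ℕ
  position x = ℕ.suc (ρ x)

  weight : Fin k → V → V → ℕ
  weight i b w = if adj G b w ∧ does (c w Fin.≟ i) then position w else 0

  weight-edge : ∀ {i b w} → Edge G b w → c w ≡ i → weight i b w ≡ position w
  weight-edge {i} {b} {w} e cw rewrite e | dec-true (c w Fin.≟ i) cw = refl

  weight-positive : ∀ {i b w} → 0 < weight i b w →
                    Edge G b w × c w ≡ i × weight i b w ≡ position w
  weight-positive {i} {b} {w} pos with adj G b w | c w Fin.≟ i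
  ... | true  | yes cw = refl , cw , refl
  ... | true  | no _   = contradiction pos (<-irrefl refl)
  ... | false | _      = contradiction pos (<-irrefl refl)

  farthest : Fin k → V → V
  farthest i b = argmax (weight i b) b (allFin (n G))

  reach : Fin k → V → ℕ
  reach i b = weight i b (farthest i b)

  position≤reach : ∀ {i b w} → Edge G b w → c w ≡ i → position w ≤ reach i b
  position≤reach {i} {b} {w} e cw =
    subst (_≤ reach i b) (weight-edge e cw)
          (All.lookup (f[xs]≤f[argmax] b (allFin (n G))) (∈-allFin w))

  interval : Fin k → V → Interval
  interval i x = if does (c x Fin.≟ i) then (position x , position x) else (0 , reach i x)

  interval-point : ∀ {i x} → c x ≡ i → interval i x ≡ (position x , position x)
  interval-point {i} {x} cx rewrite dec-true (c x Fin.≟ i) cx = refl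

  interval-star : ∀ {i x} → c x ≢ i → interval i x ≡ (0 , reach i x)
  interval-star {i} {x} cx rewrite dec-false (c x Fin.≟ i) cx = refl

  interval-valid : ∀ i x → ValidInterval (interval i x)
  interval-valid i x with does (c x Fin.≟ i)
  ... | true  = ≤-refl
  ... | false = z≤n

  meet-point-star : ∀ {i a b} → Edge G b a → c a ≡ i → c b ≢ i →
                    Meet (interval i a) (interval i b)
  meet-point-star e ca cb rewrite interval-point ca | interval-star cb =
    position≤reach e ca , z≤n

  meet-stars : ∀ {i a b} → c a ≢ i → c b ≢ i → Meet (interval i a) (interval i b)
  meet-stars ca cb rewrite interval-star ca | interval-star cb = z≤n , z≤n

  meet-edge : (∀ {u v} → Edge G u v → c u ≢ c v) →
              ∀ {u v} → Edge G u v → ∀ i → Meet (interval i u) (interval i v)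
  meet-edge proper {u} {v} e i = meet (c u Fin.≟ i) (c v Fin.≟ i)
    where
    meet : Dec (c u ≡ i) → Dec (c v ≡ i) → Meet (interval i u) (interval i v)
    meet (yes cu) (yes cv) = contradiction (trans cu (sym cv)) (proper e)
    meet (yes cu) (no cv)  = meet-point-star (Edge-sym {G} e) cu cv
    meet (no cu)  (yes cv) = swap (meet-point-star e cv cu)
    meet (no cu)  (no cv)  = meet-stars cu cv

  meet-points⇒≡ : ∀ {i a b} → c a ≡ i → c b ≡ i → Meet (interval i a) (interval i b) →
                  ρ a ≡ ρ b
  meet-points⇒≡ ca cb m with subst₂ Meet (interval-point ca) (interval-point cb) m
  ... | a≤b , b≤a = ≤-antisym (s≤s⁻¹ a≤b) (s≤s⁻¹ b≤a)

  meet-point-star⇒neighbour : ∀ {i a b} → c a ≡ i → c b ≢ i →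
                              Meet (interval i a) (interval i b) →
                              Σ V λ w → Edge G b w × c w ≡ i × ρ a ≤ ρ w
  meet-point-star⇒neighbour {i} {a} {b} ca cb m
    with proj₁ (subst₂ Meet (interval-point ca) (interval-star cb) m)
  ... | a≤reach with weight-positive {i} {b} (≤-trans (s≤s z≤n) a≤reach)
  ...   | e , cw , reach≡ =
    farthest i b , e , cw , s≤s⁻¹ (subst (position a ≤_) reach≡ a≤reach)

module WColourBox (G : Graph) {k : ℕ} (π : LinearOrder G) (c : Fin (n G) → Fin k)
                  (wcol : ∀ v u → u ≢ v → WReach G π 2 v u → c u ≢ c v) where

  private
    V : Set
    V = Fin (n G)

  rank : V → ℕ
  rank = proj₁ π

  rank-injective : Injective _≡_ _≡_ rank
  rank-injective = proj₂ π

  colour-proper : ∀ {u v} → Edge G u v → c u ≢ c v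
  colour-proper {u} {v} e with <-cmp (rank u) (rank v)
  ... | tri< u<v _ _ = wcol v u (Edge⇒≢ {G} e)
                              (wreach-edge π (s≤s z≤n) (Edge-sym {G} e) (<⇒≤ u<v))
  ... | tri≈ _ u≡v _ = contradiction (rank-injective u≡v) (Edge⇒≢ {G} e)
  ... | tri> _ _ v<u = λ cu≡cv → wcol u v (λ v≡u → Edge⇒≢ {G} e (sym v≡u))
                                      (wreach-edge π (s≤s z≤n) e (<⇒≤ v<u)) (sym cu≡cv)

  colour-apart-via-common-neighbour : ∀ {w₁ x w₂} → Edge G w₁ x → Edge G x w₂ →
                                      rank w₂ < rank w₁ → rank w₂ < rank x → c w₁ ≢ c w₂
  colour-apart-via-common-neighbour e₁ e₂ w₂<w₁ w₂<x cw₁≡cw₂ =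
    wcol _ _ w₂≢w₁
         (wreach-twoPath π ≤-refl e₁ e₂ (λ eq → w₂≢w₁ (sym eq)) (<⇒≤ w₂<w₁) (<⇒≤ w₂<x))
         (sym cw₁≡cw₂)
    where
    w₂≢w₁ : _ ≢ _
    w₂≢w₁ eq = <⇒≢ w₂<w₁ (cong rank eq)

  rank-bound : ℕ
  rank-bound = max 0 (map rank (allFin (n G)))

  rank≤rank-bound : ∀ v → rank v ≤ rank-bound
  rank≤rank-bound v =
    All.lookup (xs≤max 0 (map rank (allFin (n G)))) (∈-map⁺ rank (∈-allFin v))

  orientedRank : Fin 2 → V → ℕ
  orientedRank zero       v = rank v
  orientedRank (suc zero) v = rank-bound ∸ rank v

  open module Oriented (s : Fin 2) = ColourClassIntervals G c (orientedRank s)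
    using (interval; interval-valid; meet-edge; meet-points⇒≡; meet-point-star⇒neighbour)

  nonEdge-misses-some-orientation :
    ∀ {u v} → ¬ Edge G u v → c u ≢ c v → rank u < rank v →
    Meet (interval zero (c u) u) (interval zero (c u) v) →
    ¬ Meet (interval (suc zero) (c u) u) (interval (suc zero) (c u) v)
  nonEdge-misses-some-orientation {u} {v} ¬uv cu≢cv u<v m₀ m₁
    with meet-point-star⇒neighbour zero refl (λ eq → cu≢cv (sym eq)) m₀
       | meet-point-star⇒neighbour (suc zero) refl (λ eq → cu≢cv (sym eq)) m₁
  ... | w₁ , e₁ , cw₁ , u≤w₁ | w₂ , e₂ , cw₂ , u≤w₂ =
    colour-apart-via-common-neighbour (Edge-sym {G} e₁) e₂ w₂<w₁ (<-trans w₂<u u<v)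
                                      (trans cw₁ (sym cw₂))
    where
    w₂≤u : rank w₂ ≤ rank u
    w₂≤u = ∸-cancelʳ-≤ (rank≤rank-bound w₂) u≤w₂
    w₂<u : rank w₂ < rank u
    w₂<u = ≤∧≢⇒< w₂≤u λ eq →
      ¬uv (subst (λ w → Edge G w v) (rank-injective eq) (Edge-sym {G} e₂))
    w₂<w₁ : rank w₂ < rank w₁
    w₂<w₁ = <-≤-trans w₂<u u≤w₁

  meets-all⇒edge : ∀ {u v} → u ≢ v → (∀ s i → Meet (interval s i u) (interval s i v)) →
                   Edge G u v
  meets-all⇒edge {u} {v} u≢v meets with adj G u v ≟ᵇ true
  ... | yes e = e
  ... | no ¬uv with c u Fin.≟ c v
  ...   | yes cu≡cv =
    contradiction (rank-injective (meet-points⇒≡ zero refl (sym cu≡cv) (meets zero (c u)))) u≢v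
  ...   | no cu≢cv with <-cmp (rank u) (rank v)
  ...     | tri< u<v _ _ = ⊥-elim (nonEdge-misses-some-orientation ¬uv cu≢cv u<v
                                     (meets zero (c u)) (meets (suc zero) (c u)))
  ...     | tri≈ _ u≡v _ = contradiction (rank-injective u≡v) u≢v
  ...     | tri> _ _ v<u = ⊥-elim (nonEdge-misses-some-orientation
                                     (λ e → ¬uv (Edge-sym {G} e)) (λ eq → cu≢cv (sym eq)) v<u
                                     (swap (meets zero (c v))) (swap (meets (suc zero) (c v))))

  boxAtMost : BoxAtMost G (2 * k)
  boxAtMost = boxAtMost-* {G} interval interval-valid λ u v u≢v →
    (λ e s → meet-edge s colour-proper e) , meets-all⇒edge u≢v

theorem4 : (G : Graph) (k : ℕ) → WColStarAtMost G 2 k → BoxAtMost G (2 * k)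
theorem4 G k (π , c , wcol) = WColourBox.boxAtMost G π c wcol
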